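{- For any positive integer $r$ with $n-r>d$ and $r<d-1$, the set $\{\partial_\alpha(NW_d):\alpha\in\mathcal{M}^{[r]}\}$ consists of $|\mathcal{M}^{[r]}|=n^r$ pairwise distinct nonzero polynomials.
   Context: Let $n=2^k$, $\mathbb{F}_n$ the field with $n$ elements identified with $[n]$ via a fixed bijection, and variables $x_{i,j}$, $i,j\in[n]$. For $1\le d\le n$, $NW_d=\sum_{f\in\mathbb{F}_n[z],\ \deg f\le d-1}\prod_{i\in[n]}x_{i,f(i)}$. For $S\subseteq[n]$, $\mathcal{M}^S$ is the set of monomials $\prod_{i\in S}x_{i,j_i}$ with $(j_i)_{i\in S}\in[n]^S$ (one variable from each row $i\in S$), and $\mathcal{M}^{[r]}=\mathcal{M}^{\{1,\dots,r\}}$. For a monomial $\alpha$, $\partial_\alpha$ denotes the partial derivative with respect to $\alpha$. -}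

module Defs where

open import Data.Nat using (ℕ; zero; suc; _+_; _*_; _<?_)
open import Data.Nat.Combinatorics using (_P_)
open import Data.Nat.ListAction using (product)
open import Data.Fin using (Fin; toℕ; fromℕ<; _≟_)
open import Data.Fin.Properties using (all?)
open import Data.Vec using (Vec; []; _∷_; lookup)
open import Data.List using (List; []; _∷_; map; foldr; concatMap; allFin)
open import Data.Bool using (if_then_else_)
open import Data.Product using (∃)
open import Relation.Binary.PropositionalEquality using (_≡_; _≢_)
open import Relation.Nullary using (Dec; yes; no; does)
open import Algebra.Structures using (IsCommutativeRing)
import Data.Nat as ℕ

-- A field structure whose carrier is [n] = Fin n itself
-- (this is "F_n identified with [n] via a fixed bijection").
record FieldOn (n : ℕ) : Set where
  field
    _+F_ _*F_ : Fin n → Fin n → Fin n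
    -F_       : Fin n → Fin n
    0# 1#     : Fin n
    isCommutativeRing : IsCommutativeRing _≡_ _+F_ _*F_ -F_ 0# 1#
    0≢1       : 0# ≢ 1#
    inverse   : ∀ x → x ≢ 0# → ∃ λ y → x *F y ≡ 1#

-- Univariate polynomials over F of degree ≤ d-1, given by their
-- coefficient vector (c₀, …, c_{d-1}); evaluation by Horner's rule.
eval : ∀ {n d} → FieldOn n → Vec (Fin n) d → Fin n → Fin n
eval F []       z = FieldOn.0# F
eval F (c ∷ cs) z = FieldOn._+F_ F c (FieldOn._*F_ F z (eval F cs z))

allVecs : ∀ {n} (d : ℕ) → List (Vec (Fin n) d)
allVecs zero    = [] ∷ []
allVecs {n} (suc d) = concatMap (λ a → map (a ∷_) (allVecs d)) (allFin n)

-- Monomials in the variables x_{i,j} (i,j ∈ [n]) as exponent vectors,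
-- and polynomials with natural-number coefficients as coefficient functions.
Monomial : ℕ → Set
Monomial n = Fin n → Fin n → ℕ

Poly : ℕ → Set
Poly n = Monomial n → ℕ

_≟M_ : ∀ {n} (a b : Monomial n) → Dec (∀ i j → a i j ≡ b i j)
a ≟M b = all? (λ i → all? (λ j → a i j ℕ.≟ b i j))

zeroP : ∀ {n} → Poly n
zeroP _ = 0

_+P_ : ∀ {n} → Poly n → Poly n → Poly n
(p +P q) m = p m + q m

monoP : ∀ {n} → Monomial n → Poly n
monoP m m' = if does (m' ≟M m) then 1 else 0

graphMono : ∀ {n d} → FieldOn n → Vec (Fin n) d → Monomial n
graphMono F c i j = if does (eval F c i ≟ j) then 1 else 0

NW : ∀ {n} → FieldOn n → (d : ℕ) → Poly n
NW F d = foldr (λ c acc → monoP (graphMono F c) +P acc) zeroP (allVecs d)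

-- The monomial α = ∏_{i∈[r]} x_{i,j_i} ∈ M^{[r]}, given by (j_i) ∈ [n]^r
-- (row i ∈ [n] with toℕ i < r is the (toℕ i + 1)-th row).
rowMono : ∀ {n r} → Vec (Fin n) r → Monomial n
rowMono {r = r} J i j with toℕ i <? r
... | yes p = if does (lookup J (fromℕ< p) ≟ j) then 1 else 0
... | no _  = 0

-- Partial derivative ∂_α p, α given by its exponent vector a:
-- coefficient of x^m in ∂_α p is (∏_v (m_v+a_v)!/m_v!) · coeff of x^{m+a} in p.
∂ : ∀ {n} → Monomial n → Poly n → Poly n
∂ {n} a p m =
  product (map (λ i → product (map (λ j → (m i j + a i j) P (a i j)) (allFin n))) (allFin n))
  * p (λ i j → m i j + a i j)

-- For α = ∏_{i<r} x_{i,J(i)}, interpolation (possible since r ≤ d) gives f with deg f < d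
-- and f(i) = J(i) for i < r, so α divides the graph monomial ∏_i x_{i,f(i)} of NW_d and
-- ∂_α NW_d is nonzero at the cofactor μ = ∏_i x_{i,f(i)} / α. If ∂_{α′} NW_d were also
-- nonzero at μ, some graph monomial of g with deg g < d would equal μ·α′. On the d rows
-- r, …, r + d − 1 neither α nor α′ has a variable, so g agrees with f there, hence g = f;
-- on the rows i < r, μ has no variable, so g(i) is read off α′, giving α′ = α.
module Submission where

open import Defs
open import Data.Nat using (ℕ; _≤_; _<_; _∸_; _^_)
open import Data.Fin using (Fin)
open import Data.Vec using (Vec)
open import Data.Product using (∃; _×_)
open import Relation.Binary.PropositionalEquality using (_≡_; _≢_)

open import Algebra.Bundles using (CommutativeRing)
import Algebra.Properties.Group as GroupProperties
import Algebra.Solver.Ring.NaturalCoefficients.Default as NaturalCoefficientSolver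
open import Data.Bool using (true; if_then_else_)
open import Data.Fin using (zero; suc; toℕ; fromℕ<; inject≤; _↑ʳ_; _≟_)
open import Data.Fin.Properties
  using (0≢1+n; suc-injective; toℕ-injective; toℕ-fromℕ<; toℕ-inject≤; toℕ<n; inject≤-injective; ↑ʳ-injective; toℕ-↑ʳ)
open import Data.List using (List; []; _∷_; map; foldr; allFin)
open import Data.List.Membership.Propositional using (_∈_)
open import Data.List.Membership.Propositional.Properties using (∈-map⁺; ∈-concatMap⁺; ∈-allFin)
open import Data.List.Relation.Unary.All using (universal)
open import Data.List.Relation.Unary.All.Properties using (map⁺)
open import Data.List.Relation.Unary.Any as Any using (here; there)
open import Data.Nat as ℕ using (zero; suc; z≤n; s≤s; NonZero; _≤ᵇ_; _<?_)
open import Data.Nat.Combinatorics.Base using (_P′_; _P_)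
open import Data.Nat.ListAction using (product)
open import Data.Nat.ListAction.Properties using (product≢0)
open import Data.Nat.Properties as ℕ using ()
open import Data.Product using (_,_; proj₁; proj₂)
open import Data.Sum using (_⊎_; inj₁; inj₂)
open import Data.Vec using ([]; _∷_; replicate; lookup)
open import Data.Vec.Properties using (tabulate∘lookup; tabulate-cong)
open import Function using (_∘_)
open import Function.Definitions using (Injective)
open import Relation.Binary.PropositionalEquality using (refl; sym; trans; cong; cong₂; subst; module ≡-Reasoning)
open import Relation.Nullary using (¬_; yes; no; does; contradiction)
open import Relation.Nullary.Decidable using (dec-true; dec-false)

module PolynomialEvaluation {n : ℕ} (F : FieldOn n) where

  open FieldOn F using (isCommutativeRing; inverse)

  ring : CommutativeRing _ _
  ring = record { isCommutativeRing = isCommutativeRing }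

  open CommutativeRing ring
    using (_+_; _*_; -_; 0#; 1#; +-group; commutativeSemiring
          ; +-comm; +-assoc; +-identityʳ; *-comm; *-assoc; *-identityˡ
          ; -‿inverseʳ; zeroˡ; zeroʳ)
  open GroupProperties +-group using (∙-cancelˡ; x∙y⁻¹≈ε⇒x≈y; //-rightDividesˡ)
  open NaturalCoefficientSolver commutativeSemiring using (solve; _:+_; _:*_; _:=_)
  open ≡-Reasoning

  infixl 6 _-_
  _-_ : Fin n → Fin n → Fin n
  x - y = x + - y

  ⟦_⟧ : ∀ {L} → Vec (Fin n) L → Fin n → Fin n
  ⟦_⟧ = eval F

  x≢y⇒x-y≢0 : ∀ {x y} → x ≢ y → x - y ≢ 0#
  x≢y⇒x-y≢0 {x} {y} x≢y x-y≡0 = x≢y (x∙y⁻¹≈ε⇒x≈y x y x-y≡0)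

  inv : ∀ x → x ≢ 0# → Fin n
  inv x x≢0 = proj₁ (inverse x x≢0)

  inv-inverseʳ : ∀ x (x≢0 : x ≢ 0#) → x * inv x x≢0 ≡ 1#
  inv-inverseʳ x x≢0 = proj₂ (inverse x x≢0)

  x*[x⁻¹*y]≡y : ∀ x (x≢0 : x ≢ 0#) y → x * (inv x x≢0 * y) ≡ y
  x*[x⁻¹*y]≡y x x≢0 y = begin
    x * (inv x x≢0 * y)  ≡⟨ *-assoc x _ y ⟨
    (x * inv x x≢0) * y  ≡⟨ cong (_* y) (inv-inverseʳ x x≢0) ⟩
    1# * y               ≡⟨ *-identityˡ y ⟩
    y                    ∎

  x⁻¹*[x*y]≡y : ∀ x (x≢0 : x ≢ 0#) y → inv x x≢0 * (x * y) ≡ y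
  x⁻¹*[x*y]≡y x x≢0 y = begin
    inv x x≢0 * (x * y)  ≡⟨ *-assoc _ x y ⟨
    (inv x x≢0 * x) * y  ≡⟨ cong (_* y) (trans (*-comm _ x) (inv-inverseʳ x x≢0)) ⟩
    1# * y               ≡⟨ *-identityˡ y ⟩
    y                    ∎

  *-cancelˡ-≢0 : ∀ x {y z} → x ≢ 0# → x * y ≡ x * z → y ≡ z
  *-cancelˡ-≢0 x {y} {z} x≢0 xy≡xz = begin
    y                    ≡⟨ x⁻¹*[x*y]≡y x x≢0 y ⟨
    inv x x≢0 * (x * y)  ≡⟨ cong (inv x x≢0 *_) xy≡xz ⟩
    inv x x≢0 * (x * z)  ≡⟨ x⁻¹*[x*y]≡y x x≢0 z ⟩
    z                    ∎

  -- The solver has no negation, so −a enters as a variable b with a + b = 0# used separately.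
  eval-factor : ∀ {L} (c : Vec (Fin n) (suc L)) a →
                ∃ λ (q : Vec (Fin n) L) → ∀ z → ⟦ c ⟧ z ≡ ⟦ c ⟧ a + (z - a) * ⟦ q ⟧ z
  eval-factor (c₀ ∷ []) a = [] , λ z → begin
    c₀ + z * 0#                     ≡⟨ cong (c₀ +_) (trans (zeroʳ z) (sym (zeroʳ a))) ⟩
    c₀ + a * 0#                     ≡⟨ +-identityʳ _ ⟨
    (c₀ + a * 0#) + 0#              ≡⟨ cong (c₀ + a * 0# +_) (zeroʳ (z - a)) ⟨
    (c₀ + a * 0#) + (z - a) * 0#    ∎
  eval-factor (c₀ ∷ cs@(_ ∷ _)) a with eval-factor cs a
  ... | q , cs≡ = ⟦ cs ⟧ a ∷ q , λ z → begin
    c₀ + z * ⟦ cs ⟧ z                                    ≡⟨ cong (λ t → c₀ + z * t) (cs≡ z) ⟩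
    c₀ + z * (e + (z - a) * ⟦ q ⟧ z)                     ≡⟨ +-identityʳ _ ⟨
    c₀ + z * (e + (z - a) * ⟦ q ⟧ z) + 0#                ≡⟨ cong (c₀ + z * (e + (z - a) * ⟦ q ⟧ z) +_) [a-a]*e≡0 ⟨
    c₀ + z * (e + (z - a) * ⟦ q ⟧ z) + (a - a) * e       ≡⟨ shift z a (- a) c₀ e (⟦ q ⟧ z) ⟩
    (c₀ + a * e) + (z - a) * (e + z * ⟦ q ⟧ z)           ∎
    where
      e = ⟦ cs ⟧ a
      [a-a]*e≡0 : (a - a) * e ≡ 0#
      [a-a]*e≡0 = trans (cong (_* e) (-‿inverseʳ a)) (zeroˡ e)
      shift : ∀ z a b c₀ e q →
              c₀ + z * (e + (z + b) * q) + (a + b) * e ≡ (c₀ + a * e) + (z + b) * (e + z * q)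
      shift = solve 6 (λ z a b c₀ e q →
        c₀ :+ z :* (e :+ (z :+ b) :* q) :+ (a :+ b) :* e := (c₀ :+ a :* e) :+ (z :+ b) :* (e :+ z :* q)) refl

  eval-unique : ∀ {L} (c c′ : Vec (Fin n) L) (pts : Fin L → Fin n) → Injective _≡_ _≡_ pts →
                (∀ s → ⟦ c ⟧ (pts s) ≡ ⟦ c′ ⟧ (pts s)) → ∀ z → ⟦ c ⟧ z ≡ ⟦ c′ ⟧ z
  eval-unique [] [] _ _ _ _ = refl
  eval-unique c@(_ ∷ _) c′@(_ ∷ _) pts pts-injective agree z = begin
    ⟦ c ⟧ z                        ≡⟨ c≡ z ⟩
    ⟦ c ⟧ a + (z - a) * ⟦ q ⟧ z    ≡⟨ cong₂ (λ u v → u + (z - a) * v) (agree zero) (q≗q′ z) ⟩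
    ⟦ c′ ⟧ a + (z - a) * ⟦ q′ ⟧ z  ≡⟨ c′≡ z ⟨
    ⟦ c′ ⟧ z                       ∎
    where
      a = pts zero
      q = proj₁ (eval-factor c a)
      c≡ = proj₂ (eval-factor c a)
      q′ = proj₁ (eval-factor c′ a)
      c′≡ = proj₂ (eval-factor c′ a)
      q-agree : ∀ s → ⟦ q ⟧ (pts (suc s)) ≡ ⟦ q′ ⟧ (pts (suc s))
      q-agree s = *-cancelˡ-≢0 (x - a) (x≢y⇒x-y≢0 x≢a) (∙-cancelˡ (⟦ c ⟧ a) _ _ (begin
        ⟦ c ⟧ a + (x - a) * ⟦ q ⟧ x    ≡⟨ c≡ x ⟨
        ⟦ c ⟧ x                        ≡⟨ agree (suc s) ⟩
        ⟦ c′ ⟧ x                       ≡⟨ c′≡ x ⟩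
        ⟦ c′ ⟧ a + (x - a) * ⟦ q′ ⟧ x  ≡⟨ cong (_+ (x - a) * ⟦ q′ ⟧ x) (agree zero) ⟨
        ⟦ c ⟧ a + (x - a) * ⟦ q′ ⟧ x   ∎))
        where
          x = pts (suc s)
          x≢a : x ≢ a
          x≢a = 0≢1+n ∘ sym ∘ pts-injective
      q≗q′ : ∀ z → ⟦ q ⟧ z ≡ ⟦ q′ ⟧ z
      q≗q′ = eval-unique q q′ (pts ∘ suc) (suc-injective ∘ pts-injective) q-agree

  addConstant : ∀ {L} → Fin n → Vec (Fin n) (suc L) → Vec (Fin n) (suc L)
  addConstant y (c₀ ∷ cs) = (y + c₀) ∷ cs

  eval-addConstant : ∀ {L} y (c : Vec (Fin n) (suc L)) z → ⟦ addConstant y c ⟧ z ≡ y + ⟦ c ⟧ z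
  eval-addConstant y (c₀ ∷ cs) z = +-assoc y c₀ _

  mulLinear : ∀ {L} → Fin n → Vec (Fin n) L → Vec (Fin n) (suc L)
  mulLinear a []        = 0# ∷ []
  mulLinear a (c₀ ∷ cs) = (- a * c₀) ∷ addConstant c₀ (mulLinear a cs)

  eval-mulLinear : ∀ {L} a (c : Vec (Fin n) L) z → ⟦ mulLinear a c ⟧ z ≡ (z - a) * ⟦ c ⟧ z
  eval-mulLinear a [] z = begin
    0# + z * 0#  ≡⟨ cong (0# +_) (zeroʳ z) ⟩
    0# + 0#      ≡⟨ +-identityʳ 0# ⟩
    0#           ≡⟨ zeroʳ (z - a) ⟨
    (z - a) * 0# ∎
  eval-mulLinear a (c₀ ∷ cs) z = begin
    - a * c₀ + z * ⟦ addConstant c₀ (mulLinear a cs) ⟧ z  ≡⟨ cong (λ t → - a * c₀ + z * t) (eval-addConstant c₀ (mulLinear a cs) z) ⟩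
    - a * c₀ + z * (c₀ + ⟦ mulLinear a cs ⟧ z)            ≡⟨ cong (λ t → - a * c₀ + z * (c₀ + t)) (eval-mulLinear a cs z) ⟩
    - a * c₀ + z * (c₀ + (z - a) * ⟦ cs ⟧ z)              ≡⟨ distribute z (- a) c₀ (⟦ cs ⟧ z) ⟩
    (z - a) * (c₀ + z * ⟦ cs ⟧ z)                         ∎
    where
      distribute : ∀ z b c₀ s → b * c₀ + z * (c₀ + (z + b) * s) ≡ (z + b) * (c₀ + z * s)
      distribute = solve 4 (λ z b c₀ s → b :* c₀ :+ z :* (c₀ :+ (z :+ b) :* s) := (z :+ b) :* (c₀ :+ z :* s)) refl

  interpolate : ∀ {k L} → k ≤ L → (pts : Fin k → Fin n) → Injective _≡_ _≡_ pts → (ys : Fin k → Fin n) →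
                ∃ λ (c : Vec (Fin n) L) → ∀ s → ⟦ c ⟧ (pts s) ≡ ys s
  interpolate {L = L} z≤n _ _ _ = replicate L 0# , λ ()
  interpolate {suc k} (s≤s k≤L) pts pts-injective ys = c , c-interpolates
    where
      a = pts zero
      y = ys zero
      x-a≢0 : ∀ s → pts (suc s) - a ≢ 0#
      x-a≢0 s = x≢y⇒x-y≢0 (0≢1+n ∘ sym ∘ pts-injective)
      divided-difference : Fin k → Fin n
      divided-difference s = inv (pts (suc s) - a) (x-a≢0 s) * (ys (suc s) - y)
      tail = interpolate k≤L (pts ∘ suc) (suc-injective ∘ pts-injective) divided-difference
      p = proj₁ tail
      p-interpolates = proj₂ tail
      c = addConstant y (mulLinear a p)
      eval-c : ∀ z → ⟦ c ⟧ z ≡ y + (z - a) * ⟦ p ⟧ z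
      eval-c z = trans (eval-addConstant y (mulLinear a p) z) (cong (y +_) (eval-mulLinear a p z))
      c-interpolates : ∀ s → ⟦ c ⟧ (pts s) ≡ ys s
      c-interpolates zero = begin
        ⟦ c ⟧ a                 ≡⟨ eval-c a ⟩
        y + (a - a) * ⟦ p ⟧ a   ≡⟨ cong (λ t → y + t * ⟦ p ⟧ a) (-‿inverseʳ a) ⟩
        y + 0# * ⟦ p ⟧ a        ≡⟨ cong (y +_) (zeroˡ _) ⟩
        y + 0#                  ≡⟨ +-identityʳ y ⟩
        y                       ∎
      c-interpolates (suc s) = begin
        ⟦ c ⟧ x                                            ≡⟨ eval-c x ⟩
        y + (x - a) * ⟦ p ⟧ x                              ≡⟨ cong (λ t → y + (x - a) * t) (p-interpolates s) ⟩
        y + (x - a) * (inv (x - a) (x-a≢0 s) * (w - y))   ≡⟨ cong (y +_) (x*[x⁻¹*y]≡y (x - a) (x-a≢0 s) (w - y)) ⟩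
        y + (w - y)                                        ≡⟨ +-comm y (w - y) ⟩
        (w - y) + y                                        ≡⟨ //-rightDividesˡ y w ⟩
        w                                                  ∎
        where
          x = pts (suc s)
          w = ys (suc s)

module _ {n : ℕ} where

  infixl 7 _*M_
  _*M_ : Monomial n → Monomial n → Monomial n
  (m *M a) i j = m i j ℕ.+ a i j

  infix 4 _≈M_
  _≈M_ : Monomial n → Monomial n → Set
  m ≈M m′ = ∀ i j → m i j ≡ m′ i j

  indicator : Fin n → Fin n → ℕ
  indicator x j = if does (x ≟ j) then 1 else 0

  indicator-self : ∀ x → indicator x x ≡ 1
  indicator-self x = cong (if_then 1 else 0) (dec-true (x ≟ x) refl)

  indicator-≢ : ∀ {x y} → x ≢ y → indicator x y ≡ 0
  indicator-≢ {x} {y} x≢y = cong (if_then 1 else 0) (dec-false (x ≟ y) x≢y)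

  indicator-injective : ∀ {x y} → (∀ j → indicator x j ≡ indicator y j) → x ≡ y
  indicator-injective {x} {y} same with x ≟ y
  ... | yes x≡y = x≡y
  ... | no x≢y  = contradiction (trans (sym (indicator-≢ x≢y)) (trans (same y) (indicator-self y))) λ ()

  monoP-≡1 : ∀ {g m : Monomial n} → m ≈M g → monoP g m ≡ 1
  monoP-≡1 {g} {m} m≈g = cong (if_then 1 else 0) (dec-true (m ≟M g) m≈g)

  monoP-≡0 : ∀ {g m : Monomial n} → ¬ m ≈M g → monoP g m ≡ 0
  monoP-≡0 {g} {m} m≉g = cong (if_then 1 else 0) (dec-false (m ≟M g) m≉g)

  module _ {A : Set} (g : A → Monomial n) where

    sumMonoP : List A → Poly n
    sumMonoP = foldr (λ c acc → monoP (g c) +P acc) zeroP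

    sumMonoP-≢0 : ∀ {c cs} m → c ∈ cs → m ≈M g c → sumMonoP cs m ≢ 0
    sumMonoP-≢0 m (here refl)  m≈gc = ℕ.1+n≢0 ∘ trans (sym (monoP-≡1 m≈gc)) ∘ ℕ.m+n≡0⇒m≡0 _
    sumMonoP-≢0 m (there c∈cs) m≈gc = sumMonoP-≢0 m c∈cs m≈gc ∘ ℕ.m+n≡0⇒n≡0 _

    sumMonoP-≡0 : ∀ cs m → (∀ c → ¬ m ≈M g c) → sumMonoP cs m ≡ 0
    sumMonoP-≡0 []       m _         = refl
    sumMonoP-≡0 (c ∷ cs) m no-match = cong₂ ℕ._+_ (monoP-≡0 (no-match c)) (sumMonoP-≡0 cs m no-match)

∈-allVecs : ∀ {n} d (c : Vec (Fin n) d) → c ∈ allVecs d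
∈-allVecs zero    []      = here refl
∈-allVecs (suc d) (a ∷ c) =
  ∈-concatMap⁺ (λ a → map (a ∷_) (allVecs d)) (Any.map (λ { refl → ∈-map⁺ (a ∷_) (∈-allVecs d c) }) (∈-allFin a))

P′-nonZero : ∀ {m} k → k ≤ m → NonZero (m P′ k)
P′-nonZero         zero    _     = _
P′-nonZero {m = m} (suc k) 1+k≤m =
  ℕ.m*n≢0 (m ∸ k) (m P′ k) {{ℕ.≢-nonZero (ℕ.m>n⇒m∸n≢0 1+k≤m)}} {{P′-nonZero k (ℕ.<⇒≤ 1+k≤m)}}

P-nonZero : ∀ {m k} → k ≤ m → NonZero (m P k)
P-nonZero {m} {k} k≤m with k ≤ᵇ m | ℕ.≤⇒≤ᵇ k≤m
... | true | _ = P′-nonZero k k≤m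

product-map-nonZero : ∀ {A : Set} {f : A → ℕ} → (∀ x → NonZero (f x)) → ∀ xs → NonZero (product (map f xs))
product-map-nonZero f≢0 xs = product≢0 (map⁺ (universal f≢0 xs))

module _ {n : ℕ} (a : Monomial n) (p : Poly n) (m : Monomial n) where

  ∂-multiplier : ℕ
  ∂-multiplier = product (map (λ i → product (map (λ j → (m i j ℕ.+ a i j) P a i j) (allFin n))) (allFin n))

  ∂-multiplier-nonZero : NonZero ∂-multiplier
  ∂-multiplier-nonZero = product-map-nonZero (λ i →
    product-map-nonZero (λ j → P-nonZero (ℕ.m≤n+m (a i j) (m i j))) (allFin n)) (allFin n)

  ∂-≢0 : p (m *M a) ≢ 0 → ∂ a p m ≢ 0
  ∂-≢0 p≢0 = ℕ.≢-nonZero⁻¹ _ {{ℕ.m*n≢0 ∂-multiplier _ {{∂-multiplier-nonZero}} {{ℕ.≢-nonZero p≢0}}}}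

  ∂-≡0 : p (m *M a) ≡ 0 → ∂ a p m ≡ 0
  ∂-≡0 p≡0 = trans (cong (∂-multiplier ℕ.*_) p≡0) (ℕ.*-zeroʳ ∂-multiplier)

module _ {n r : ℕ} (J : Vec (Fin n) r) where

  rowMono-inject≤ : (r≤n : r ≤ n) → ∀ t j → rowMono J (inject≤ t r≤n) j ≡ indicator (lookup J t) j
  rowMono-inject≤ r≤n t j with toℕ (inject≤ t r≤n) <? r
  ... | yes i<r = cong (λ t′ → indicator (lookup J t′) j)
                       (toℕ-injective (trans (toℕ-fromℕ< i<r) (toℕ-inject≤ t r≤n)))
  ... | no i≮r  = contradiction (subst (_< r) (sym (toℕ-inject≤ t r≤n)) (toℕ<n t)) i≮r

  rowMono-≥ : ∀ {i} → r ≤ toℕ i → ∀ j → rowMono J i j ≡ 0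
  rowMono-≥ {i} r≤i j with toℕ i <? r
  ... | yes i<r = contradiction r≤i (ℕ.<⇒≱ i<r)
  ... | no _    = refl

inject≤-image-or-≥ : ∀ {n r} (r≤n : r ≤ n) (i : Fin n) → (∃ λ t → inject≤ t r≤n ≡ i) ⊎ r ≤ toℕ i
inject≤-image-or-≥ {r = r} r≤n i with toℕ i <? r
... | yes i<r = inj₁ (fromℕ< i<r , toℕ-injective (trans (toℕ-inject≤ _ r≤n) (toℕ-fromℕ< i<r)))
... | no i≮r  = inj₂ (ℕ.≮⇒≥ i≮r)

lookup-injective : ∀ {A : Set} {r} {J J′ : Vec A r} → (∀ t → lookup J t ≡ lookup J′ t) → J ≡ J′
lookup-injective {J = J} {J′} J≗J′ =
  trans (sym (tabulate∘lookup J)) (trans (tabulate-cong J≗J′) (tabulate∘lookup J′))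

module Cofactors {n : ℕ} (F : FieldOn n) {r d : ℕ} (r≤d : r ≤ d) (r+d≤n : r ℕ.+ d ≤ n) where

  open PolynomialEvaluation F using (interpolate; eval-unique)

  r≤n : r ≤ n
  r≤n = ℕ.≤-trans (ℕ.m≤m+n r d) r+d≤n

  lowRow : Fin r → Fin n
  lowRow t = inject≤ t r≤n

  highRow : Fin d → Fin n
  highRow s = inject≤ (r ↑ʳ s) r+d≤n

  lowRow-injective : Injective _≡_ _≡_ lowRow
  lowRow-injective = inject≤-injective r≤n r≤n _ _

  highRow-injective : Injective _≡_ _≡_ highRow
  highRow-injective = ↑ʳ-injective r _ _ ∘ inject≤-injective r+d≤n r+d≤n _ _

  r≤highRow : ∀ s → r ≤ toℕ (highRow s)
  r≤highRow s = subst (r ≤_) (sym (trans (toℕ-inject≤ (r ↑ʳ s) r+d≤n) (toℕ-↑ʳ r s))) (ℕ.m≤m+n r (toℕ s))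

  interpolant : Vec (Fin n) r → Vec (Fin n) d
  interpolant J = proj₁ (interpolate r≤d lowRow lowRow-injective (lookup J))

  interpolant-lowRow : ∀ J t → eval F (interpolant J) (lowRow t) ≡ lookup J t
  interpolant-lowRow J = proj₂ (interpolate r≤d lowRow lowRow-injective (lookup J))

  cofactor : Vec (Fin n) r → Monomial n
  cofactor J i j = graphMono F (interpolant J) i j ∸ rowMono J i j

  rowMono≤graphMono : ∀ J i j → rowMono J i j ≤ graphMono F (interpolant J) i j
  rowMono≤graphMono J i j with inject≤-image-or-≥ r≤n i
  ... | inj₁ (t , refl) = ℕ.≤-reflexive (begin
    rowMono J (lowRow t) j                       ≡⟨ rowMono-inject≤ J r≤n t j ⟩
    indicator (lookup J t) j                     ≡⟨ cong (λ x → indicator x j) (interpolant-lowRow J t) ⟨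
    graphMono F (interpolant J) (lowRow t) j     ∎)
    where open ≡-Reasoning
  ... | inj₂ r≤i = subst (_≤ graphMono F (interpolant J) i j) (sym (rowMono-≥ J r≤i j)) z≤n

  cofactor-*M-rowMono : ∀ J → cofactor J *M rowMono J ≈M graphMono F (interpolant J)
  cofactor-*M-rowMono J i j = ℕ.m∸n+n≡m (rowMono≤graphMono J i j)

  cofactor-lowRow : ∀ J t j → cofactor J (lowRow t) j ≡ 0
  cofactor-lowRow J t j = trans
    (cong₂ _∸_ (cong (λ x → indicator x j) (interpolant-lowRow J t)) (rowMono-inject≤ J r≤n t j))
    (ℕ.n∸n≡0 (indicator (lookup J t) j))

  cofactor-highRow : ∀ J s j → cofactor J (highRow s) j ≡ graphMono F (interpolant J) (highRow s) j
  cofactor-highRow J s j = cong (graphMono F (interpolant J) (highRow s) j ∸_) (rowMono-≥ J (r≤highRow s) j)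

  cofactor-*M-rowMono-graph⇒≡ : ∀ J J′ (c : Vec (Fin n) d) → cofactor J *M rowMono J′ ≈M graphMono F c → J ≡ J′
  cofactor-*M-rowMono-graph⇒≡ J J′ c split = lookup-injective λ t → begin
    lookup J t                          ≡⟨ interpolant-lowRow J t ⟨
    eval F (interpolant J) (lowRow t)   ≡⟨ eval-unique (interpolant J) c highRow highRow-injective agree-high (lowRow t) ⟩
    eval F c (lowRow t)                 ≡⟨ indicator-injective (graph-lowRow t) ⟩
    lookup J′ t                         ∎
    where
      open ≡-Reasoning
      agree-high : ∀ s → eval F (interpolant J) (highRow s) ≡ eval F c (highRow s)
      agree-high s = indicator-injective λ j → begin
        graphMono F (interpolant J) (highRow s) j         ≡⟨ cofactor-highRow J s j ⟨
        cofactor J (highRow s) j                          ≡⟨ ℕ.+-identityʳ _ ⟨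
        cofactor J (highRow s) j ℕ.+ 0                    ≡⟨ cong (_ ℕ.+_) (rowMono-≥ J′ (r≤highRow s) j) ⟨
        cofactor J (highRow s) j ℕ.+ rowMono J′ (highRow s) j ≡⟨ split (highRow s) j ⟩
        graphMono F c (highRow s) j                       ∎
      graph-lowRow : ∀ t j → graphMono F c (lowRow t) j ≡ indicator (lookup J′ t) j
      graph-lowRow t j = begin
        graphMono F c (lowRow t) j                          ≡⟨ split (lowRow t) j ⟨
        cofactor J (lowRow t) j ℕ.+ rowMono J′ (lowRow t) j ≡⟨ cong₂ ℕ._+_ (cofactor-lowRow J t j) (rowMono-inject≤ J′ r≤n t j) ⟩
        indicator (lookup J′ t) j                           ∎

lemma4p3 : (n k : ℕ) → n ≡ 2 ^ k → (F : FieldOn n) → (d r : ℕ) →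
    1 ≤ d → d ≤ n → 1 ≤ r → d < n ∸ r → r < d ∸ 1 →
    ((J : Vec (Fin n) r) → ∃ λ m → ∂ (rowMono J) (NW F d) m ≢ 0)
    × ((J J′ : Vec (Fin n) r) → J ≢ J′ →
        ∃ λ m → ∂ (rowMono J) (NW F d) m ≢ ∂ (rowMono J′) (NW F d) m)
lemma4p3 n _ _ F d r _ _ _ d<n∸r r<d∸1 = (λ J → cofactor J , ∂NW-cofactor≢0 J) , distinct
  where
    r<n : r < n
    r<n = ℕ.m∸n≢0⇒n<m (λ n∸r≡0 → ℕ.n≮0 (subst (d <_) n∸r≡0 d<n∸r))
    r+d≤n : r ℕ.+ d ≤ n
    r+d≤n = subst (r ℕ.+ d ≤_) (ℕ.m+[n∸m]≡n (ℕ.<⇒≤ r<n)) (ℕ.+-monoʳ-≤ r (ℕ.<⇒≤ d<n∸r))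
    open Cofactors F (ℕ.≤-trans (ℕ.<⇒≤ r<d∸1) (ℕ.m∸n≤m d 1)) r+d≤n
    ∂NW-cofactor≢0 : ∀ J → ∂ (rowMono J) (NW F d) (cofactor J) ≢ 0
    ∂NW-cofactor≢0 J = ∂-≢0 (rowMono J) (NW F d) (cofactor J)
      (sumMonoP-≢0 (graphMono F) _ (∈-allVecs d (interpolant J)) (cofactor-*M-rowMono J))
    ∂NW-other-cofactor≡0 : ∀ J J′ → J ≢ J′ → ∂ (rowMono J′) (NW F d) (cofactor J) ≡ 0
    ∂NW-other-cofactor≡0 J J′ J≢J′ = ∂-≡0 (rowMono J′) (NW F d) (cofactor J)
      (sumMonoP-≡0 (graphMono F) (allVecs d) (cofactor J *M rowMono J′)
        λ c split → J≢J′ (cofactor-*M-rowMono-graph⇒≡ J J′ c split))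
    distinct : ∀ J J′ → J ≢ J′ → ∃ λ m → ∂ (rowMono J) (NW F d) m ≢ ∂ (rowMono J′) (NW F d) m
    distinct J J′ J≢J′ =
      cofactor J , λ same → ∂NW-cofactor≢0 J (trans same (∂NW-other-cofactor≡0 J J′ J≢J′))
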